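{- Let $\mathbb{F}$ be any field, let $G=([n],E)$ and $H=([n],F)$ be directed graphs with graphical matrix spaces $\mathcal{S}_G,\mathcal{S}_H\le\mathrm{M}(n,\mathbb{F})$. If $\mathcal{S}_G$ is congruent to a subspace of $\mathcal{S}_H$, i.e. there is $T\in\mathrm{GL}(n,\mathbb{F})$ with $T\mathcal{S}_GT^t\le\mathcal{S}_H$, then $G$ is isomorphic to a subgraph of $H$.
   Context: Directed graphs have arc sets contained in $[n]\times[n]$; $\mathcal{S}_G=\langle\mathrm{E}_{i,j}\mid (i,j)\in E\rangle$ where $\mathrm{E}_{i,j}$ is the elementary matrix with $1$ at $(i,j)$. $G$ is isomorphic to a subgraph of $H$ if there is a permutation $\sigma$ of $[n]$ with $(\sigma(i),\sigma(j))\in F$ for all $(i,j)\in E$. $T\mathcal{S}T^t=\{TBT^t\mid B\in\mathcal{S}\}$. -}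

module Defs where

open import Level using (Level; _⊔_) renaming (suc to lsuc)
open import Data.Bool using (Bool; true; false; if_then_else_)
open import Data.Fin using (Fin; zero; suc; _≟_)
open import Data.Fin.Permutation using (Permutation′; _⟨$⟩ʳ_)
open import Data.Nat using (ℕ; zero; suc)
open import Data.Product using (Σ; _×_; ∃)
open import Relation.Nullary using (¬_; does)
open import Relation.Binary.PropositionalEquality using (_≡_)
open import Algebra.Bundles using (CommutativeRing)

record Field (c ℓ : Level) : Set (lsuc (c ⊔ ℓ)) where
  field
    commutativeRing : CommutativeRing c ℓ
  open CommutativeRing commutativeRing public
  field
    1≉0 : ¬ (1# ≈ 0#)
    inverse : ∀ x → ¬ (x ≈ 0#) → ∃ λ y → x * y ≈ 1#

-- A directed graph on vertex set [n] = Fin n; arc set E ⊆ [n]×[n]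
-- given by its (Boolean) indicator: (i , j) ∈ E  iff  E i j ≡ true.
Digraph : ℕ → Set
Digraph n = Fin n → Fin n → Bool

module MatrixOver {c ℓ} (𝔽 : Field c ℓ) where
  open Field 𝔽 using (Carrier; _≈_; _+_; _*_; 0#; 1#)

  Matrix : ℕ → Set c
  Matrix n = Fin n → Fin n → Carrier

  _≈ᴹ_ : ∀ {n} → Matrix n → Matrix n → Set ℓ
  A ≈ᴹ B = ∀ i j → A i j ≈ B i j

  ∑ : ∀ {n} → (Fin n → Carrier) → Carrier
  ∑ {zero} f = 0#
  ∑ {suc n} f = f zero + ∑ (λ i → f (suc i))

  _·ᴹ_ : ∀ {n} → Matrix n → Matrix n → Matrix n
  (A ·ᴹ B) i j = ∑ (λ k → A i k * B k j)

  _ᵗ : ∀ {n} → Matrix n → Matrix n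
  (A ᵗ) i j = A j i

  δ : ∀ {n} → Fin n → Fin n → Carrier
  δ i j = if does (i ≟ j) then 1# else 0#

  Iᴹ : ∀ {n} → Matrix n
  Iᴹ = δ

  Elem : ∀ {n} → Fin n → Fin n → Matrix n
  Elem i j k l = δ i k * δ j l

  _+ᴹ_ : ∀ {n} → Matrix n → Matrix n → Matrix n
  (A +ᴹ B) i j = A i j + B i j

  _∙ᴹ_ : ∀ {n} → Carrier → Matrix n → Matrix n
  (a ∙ᴹ A) i j = a * A i j

  0ᴹ : ∀ {n} → Matrix n
  0ᴹ i j = 0#

  ∑ᴹ : ∀ {n m} → (Fin m → Matrix n) → Matrix n
  ∑ᴹ {m = zero} f = 0ᴹ
  ∑ᴹ {m = suc m} f = f zero +ᴹ ∑ᴹ (λ i → f (suc i))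

  Invertible : ∀ {n} → Matrix n → Set (c ⊔ ℓ)
  Invertible {n} T = Σ (Matrix n) λ U → ((T ·ᴹ U) ≈ᴹ Iᴹ) × ((U ·ᴹ T) ≈ᴹ Iᴹ)

  _∈𝒮_ : ∀ {n} → Matrix n → Digraph n → Set (c ⊔ ℓ)
  _∈𝒮_ {n} M G =
    Σ (Fin n → Fin n → Carrier) λ coef →
      M ≈ᴹ ∑ᴹ (λ i → ∑ᴹ (λ j →
              if G i j then coef i j ∙ᴹ Elem i j else 0ᴹ))

  CongruentInto : ∀ {n} → Matrix n → Digraph n → Digraph n → Set (c ⊔ ℓ)
  CongruentInto {n} T G H = ∀ (B : Matrix n) → B ∈𝒮 G → ((T ·ᴹ B) ·ᴹ (T ᵗ)) ∈𝒮 H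

IsoToSubgraph : ∀ {n} → Digraph n → Digraph n → Set
IsoToSubgraph {n} G H =
  Σ (Permutation′ n) λ σ →
    ∀ i j → G i j ≡ true → H (σ ⟨$⟩ʳ i) (σ ⟨$⟩ʳ j) ≡ true

-- If T is invertible, some permutation σ has T (σ i) i ≠ 0 for every i (a nonzero
-- term of the Leibniz expansion of det T; found here by induction, clearing one column
-- of the inverse with a pivot).  The congruence T E_ij Tᵗ has (p, q)-entry T p i * T q j,
-- nonzero at (σ i, σ j); as T 𝒮_G Tᵗ ≤ 𝒮_H, the arc (σ i, σ j) lies in H.
-- Zero-testing in 𝔽 is not decidable, so σ exists only up to double negation; being an
-- embedding is decidable, and there are finitely many permutations, so the double
-- negation can be removed.
module Submission where

open import Defs
open import Level using (Level)
open import Data.Nat using (ℕ; zero; suc)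
open import Data.Bool using (true; false; if_then_else_)
import Data.Bool.Properties as Bool
open import Data.Empty using (⊥-elim)
open import Data.Fin using (Fin; zero; suc; _≟_; punchIn)
open import Data.Fin.Properties using (punchInᵢ≢i; any?; all?)
open import Data.Fin.Permutation as Perm
  using (Permutation′; _⟨$⟩ʳ_; insert; remove; insert-remove; insert-punchIn)
open import Data.Product using (∃; _,_)
open import Data.Vec.Functional using (removeAt)
open import Function using (_∘_)
open import Relation.Nullary using (¬_; Dec; yes; no)
open import Relation.Nullary.Decidable using (_→-dec_; decidable-stable)
open import Relation.Binary.PropositionalEquality as ≡ using (_≡_)

insert-cong : ∀ {n} (k : Fin (suc n)) {π ρ : Permutation′ n} →
              π Perm.≈ ρ → insert zero k π Perm.≈ insert zero k ρ
insert-cong k π≈ρ zero = ≡.refl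
insert-cong k {π} {ρ} π≈ρ (suc i) = begin
  insert zero k π ⟨$⟩ʳ suc i ≡⟨ insert-punchIn zero k π i ⟩
  punchIn k (π ⟨$⟩ʳ i)       ≡⟨ ≡.cong (punchIn k) (π≈ρ i) ⟩
  punchIn k (ρ ⟨$⟩ʳ i)       ≡⟨ insert-punchIn zero k ρ i ⟨
  insert zero k ρ ⟨$⟩ʳ suc i ∎
  where open ≡.≡-Reasoning

any?-Permutation : ∀ {p} n {P : Permutation′ n → Set p} →
                   (∀ {π ρ} → π Perm.≈ ρ → P π → P ρ) →
                   (∀ π → Dec (P π)) → Dec (∃ P)
any?-Permutation zero resp P? with P? Perm.id
... | yes p = yes (Perm.id , p)
... | no ¬p = no λ (π , p) → ¬p (resp (λ ()) p)
any?-Permutation (suc n) resp P?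
  with any? (λ k → any?-Permutation n (resp ∘ insert-cong k) (P? ∘ insert zero k))
... | yes (k , π , p) = yes (insert zero k π , p)
... | no ¬p = no λ (π , p) →
  ¬p (π ⟨$⟩ʳ zero , remove zero π , resp (≡.sym ∘ insert-remove zero π) p)

IsEmbedding : ∀ {n} → Digraph n → Digraph n → Permutation′ n → Set
IsEmbedding G H σ = ∀ i j → G i j ≡ true → H (σ ⟨$⟩ʳ i) (σ ⟨$⟩ʳ j) ≡ true

isEmbedding? : ∀ {n} (G H : Digraph n) σ → Dec (IsEmbedding G H σ)
isEmbedding? G H σ = all? λ i → all? λ j →
  (G i j Bool.≟ true) →-dec (H (σ ⟨$⟩ʳ i) (σ ⟨$⟩ʳ j) Bool.≟ true)

IsEmbedding-resp-≈ : ∀ {n} (G H : Digraph n) {π ρ} →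
                   π Perm.≈ ρ → IsEmbedding G H π → IsEmbedding G H ρ
IsEmbedding-resp-≈ G H π≈ρ emb i j Gij =
  ≡.subst₂ (λ a b → H a b ≡ true) (π≈ρ i) (π≈ρ j) (emb i j Gij)

module _ {c ℓ} (𝔽 : Field c ℓ) where
  open Field 𝔽 hiding (zero)
  open MatrixOver 𝔽
  open import Algebra.Properties.Ring ring using (-‿distribˡ-*)
  open import Algebra.Properties.CommutativeSemigroup *-commutativeSemigroup
    using (x∙yz≈y∙xz; xy∙z≈y∙xz)
  open import Algebra.Properties.Semiring.Sum semiring
    using (sum; sum-cong-≋; sum-replicate-zero; sum-remove; ∑-distrib-+; *-distribˡ-sum)
  open import Relation.Binary.Reasoning.Setoid setoid

  ∑≈sum : ∀ {n} (f : Fin n → Carrier) → ∑ f ≈ sum f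
  ∑≈sum {zero} f = refl
  ∑≈sum {suc n} f = +-congˡ (∑≈sum (f ∘ suc))

  ∑-cong : ∀ {n} {f g : Fin n → Carrier} → (∀ i → f i ≈ g i) → ∑ f ≈ ∑ g
  ∑-cong {f = f} {g} f≈g = trans (∑≈sum f) (trans (sum-cong-≋ f≈g) (sym (∑≈sum g)))

  ∑-zero : ∀ {n} {f : Fin n → Carrier} → (∀ i → f i ≈ 0#) → ∑ f ≈ 0#
  ∑-zero {n} {f} f≈0 = begin
    ∑ f            ≈⟨ ∑-cong f≈0 ⟩
    ∑ {n} (λ _ → 0#)   ≈⟨ ∑≈sum {n} (λ _ → 0#) ⟩
    sum {n} (λ _ → 0#) ≈⟨ sum-replicate-zero n ⟩
    0#             ∎

  ∑-+ : ∀ {n} (f g : Fin n → Carrier) → ∑ (λ i → f i + g i) ≈ ∑ f + ∑ g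
  ∑-+ f g = begin
    ∑ (λ i → f i + g i) ≈⟨ ∑≈sum (λ i → f i + g i) ⟩
    sum (λ i → f i + g i) ≈⟨ ∑-distrib-+ f g ⟩
    sum f + sum g       ≈⟨ +-cong (∑≈sum f) (∑≈sum g) ⟨
    ∑ f + ∑ g           ∎

  *-distribˡ-∑ : ∀ {n} x (f : Fin n → Carrier) → x * ∑ f ≈ ∑ (λ i → x * f i)
  *-distribˡ-∑ x f = begin
    x * ∑ f             ≈⟨ *-congˡ (∑≈sum f) ⟩
    x * sum f           ≈⟨ *-distribˡ-sum x f ⟩
    sum (λ i → x * f i) ≈⟨ ∑≈sum (λ i → x * f i) ⟨
    ∑ (λ i → x * f i)   ∎

  ∑-remove : ∀ {n} (k : Fin (suc n)) (f : Fin (suc n) → Carrier) →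
             ∑ f ≈ f k + ∑ (removeAt f k)
  ∑-remove k f = begin
    ∑ f                       ≈⟨ ∑≈sum f ⟩
    sum f                     ≈⟨ sum-remove f ⟩
    f k + sum (removeAt f k)  ≈⟨ +-congˡ (∑≈sum (removeAt f k)) ⟨
    f k + ∑ (removeAt f k)    ∎

  ∑ᴹ-entry : ∀ {n m} (F : Fin m → Matrix n) p q → ∑ᴹ F p q ≈ ∑ (λ k → F k p q)
  ∑ᴹ-entry {m = zero} F p q = refl
  ∑ᴹ-entry {m = suc m} F p q = +-congˡ (∑ᴹ-entry (F ∘ suc) p q)

  δ-refl : ∀ {n} (i : Fin n) → δ i i ≈ 1#
  δ-refl i with i ≟ i
  ... | yes _ = refl
  ... | no i≢i = ⊥-elim (i≢i ≡.refl)

  δ-≢ : ∀ {n} {i j : Fin n} → ¬ i ≡ j → δ i j ≈ 0#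
  δ-≢ {i = i} {j} i≢j with i ≟ j
  ... | yes i≡j = ⊥-elim (i≢j i≡j)
  ... | no _ = refl

  δ-sym : ∀ {n} (i j : Fin n) → δ i j ≈ δ j i
  δ-sym i j with i ≟ j | j ≟ i
  ... | yes _ | yes _ = refl
  ... | no _ | no _ = refl
  ... | yes i≡j | no j≢i = ⊥-elim (j≢i (≡.sym i≡j))
  ... | no i≢j | yes j≡i = ⊥-elim (i≢j (≡.sym j≡i))

  ∑-δ : ∀ {n} (i : Fin n) (f : Fin n → Carrier) → ∑ (λ k → δ i k * f k) ≈ f i
  ∑-δ {suc n} i f = begin
    ∑ (λ k → δ i k * f k)                     ≈⟨ ∑-remove i (λ k → δ i k * f k) ⟩
    δ i i * f i + ∑ (removeAt (λ k → δ i k * f k) i)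
      ≈⟨ +-cong (trans (*-congʳ (δ-refl i)) (*-identityˡ (f i))) (∑-zero off-diagonal) ⟩
    f i + 0#                                  ≈⟨ +-identityʳ (f i) ⟩
    f i                                       ∎
    where
    off-diagonal : ∀ r → δ i (punchIn i r) * f (punchIn i r) ≈ 0#
    off-diagonal r = trans (*-congʳ (δ-≢ (punchInᵢ≢i i r ∘ ≡.sym))) (zeroˡ _)

  x≉0∧y≉0⇒xy≉0 : ∀ {x y} → x ≉ 0# → y ≉ 0# → x * y ≉ 0#
  x≉0∧y≉0⇒xy≉0 {x} {y} x≉0 y≉0 xy≈0 with inverse x x≉0
  ... | x⁻¹ , xx⁻¹≈1 = y≉0 (begin
    y             ≈⟨ *-identityˡ y ⟨
    1# * y        ≈⟨ *-congʳ (trans (sym xx⁻¹≈1) (*-comm x x⁻¹)) ⟩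
    x⁻¹ * x * y   ≈⟨ *-assoc x⁻¹ x y ⟩
    x⁻¹ * (x * y) ≈⟨ *-congˡ xy≈0 ⟩
    x⁻¹ * 0#      ≈⟨ zeroʳ x⁻¹ ⟩
    0#            ∎)

  xy≉0⇒x≉0 : ∀ {x y} → x * y ≉ 0# → x ≉ 0#
  xy≉0⇒x≉0 {y = y} xy≉0 x≈0 = xy≉0 (trans (*-congʳ x≈0) (zeroˡ y))

  xy≉0⇒y≉0 : ∀ {x y} → x * y ≉ 0# → y ≉ 0#
  xy≉0⇒y≉0 {x} xy≉0 y≈0 = xy≉0 (trans (*-congˡ y≈0) (zeroʳ x))

  ∑≉0⇒¬¬∃≉0 : ∀ {n} (f : Fin n → Carrier) → ∑ f ≉ 0# → ¬ ¬ ∃ λ k → f k ≉ 0#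
  ∑≉0⇒¬¬∃≉0 {zero} f ∑f≉0 _ = ∑f≉0 refl
  ∑≉0⇒¬¬∃≉0 {suc n} f ∑f≉0 ¬∃ = ∑≉0⇒¬¬∃≉0 (f ∘ suc) ∑tail≉0 λ (k , fk≉0) → ¬∃ (suc k , fk≉0)
    where
    ∑tail≉0 : ∑ (f ∘ suc) ≉ 0#
    ∑tail≉0 ∑tail≈0 = ¬∃ (zero , λ f0≈0 → ∑f≉0 (trans (+-cong f0≈0 ∑tail≈0) (+-identityˡ 0#)))

  minor : ∀ {n} → Matrix (suc n) → Fin (suc n) → Matrix n
  minor T k i j = T (punchIn k i) (suc j)

  addRow₀ : ∀ {n} → Matrix (suc n) → (Fin n → Carrier) → Fin n → Fin (suc n) → Carrier
  addRow₀ U d a r = U (suc a) r + d a * U zero r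

  -- Row 0 of U ·ᴹ T vanishes off column 0, so adding multiples of row 0 of U to the
  -- other rows keeps a left inverse of T with its column 0 deleted.
  addRow₀-leftInverse : ∀ {n} {T U : Matrix (suc n)} → (U ·ᴹ T) ≈ᴹ Iᴹ →
                        ∀ d a b → ∑ (λ r → addRow₀ U d a r * T r (suc b)) ≈ δ a b
  addRow₀-leftInverse {T = T} {U} U·T≈I d a b = begin
    ∑ (λ r → (U (suc a) r + d a * U zero r) * T r (suc b))
      ≈⟨ ∑-cong (λ r → trans (distribʳ (T r (suc b)) (U (suc a) r) (d a * U zero r))
                                 (+-congˡ (*-assoc (d a) (U zero r) (T r (suc b))))) ⟩
    ∑ (λ r → U (suc a) r * T r (suc b) + d a * (U zero r * T r (suc b)))
      ≈⟨ trans (∑-+ (λ r → U (suc a) r * T r (suc b)) (λ r → d a * (U zero r * T r (suc b))))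
               (+-congˡ (sym (*-distribˡ-∑ (d a) (λ r → U zero r * T r (suc b))))) ⟩
    (U ·ᴹ T) (suc a) (suc b) + d a * (U ·ᴹ T) zero (suc b)
      ≈⟨ +-cong (U·T≈I (suc a) (suc b)) (*-congˡ (U·T≈I zero (suc b))) ⟩
    δ a b + d a * 0#
      ≈⟨ trans (+-congˡ (zeroʳ (d a))) (+-identityʳ (δ a b)) ⟩
    δ a b ∎

  -- With y = (U 0 k)⁻¹ the multiplier clears column k, so dropping that column
  -- (and row k of T) loses nothing.
  reducedInverse : ∀ {n} → Matrix (suc n) → Fin (suc n) → Carrier → Matrix n
  reducedInverse U k y a r = addRow₀ U (λ a → - (U (suc a) k * y)) a (punchIn k r)

  reducedInverse-leftInverse : ∀ {n} {T U : Matrix (suc n)} → (U ·ᴹ T) ≈ᴹ Iᴹ →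
                               ∀ k {y} → U zero k * y ≈ 1# →
                               (reducedInverse U k y ·ᴹ minor T k) ≈ᴹ Iᴹ
  reducedInverse-leftInverse {T = T} {U} U·T≈I k {y} uy≈1 a b = begin
    ∑ (removeAt f k)       ≈⟨ +-identityˡ _ ⟨
    0# + ∑ (removeAt f k)  ≈⟨ +-congʳ (trans (*-congʳ cleared) (zeroˡ _)) ⟨
    f k + ∑ (removeAt f k) ≈⟨ ∑-remove k f ⟨
    ∑ f                    ≈⟨ addRow₀-leftInverse {T = T} {U} U·T≈I d a b ⟩
    δ a b                  ∎
    where
    d : Fin _ → Carrier
    d a = - (U (suc a) k * y)
    f : Fin _ → Carrier
    f r = addRow₀ U d a r * T r (suc b)
    cleared : addRow₀ U d a k ≈ 0#
    cleared = begin
      U (suc a) k + - (U (suc a) k * y) * U zero k ≈⟨ +-congˡ (-‿distribˡ-* _ _) ⟨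
      U (suc a) k - (U (suc a) k * y) * U zero k   ≈⟨ +-congˡ (-‿cong (*-assoc _ _ _)) ⟩
      U (suc a) k - U (suc a) k * (y * U zero k)   ≈⟨ +-congˡ (-‿cong (*-congˡ (trans (*-comm _ _) uy≈1))) ⟩
      U (suc a) k - U (suc a) k * 1#               ≈⟨ +-congˡ (-‿cong (*-identityʳ _)) ⟩
      U (suc a) k - U (suc a) k                    ≈⟨ -‿inverseʳ _ ⟩
      0#                                           ∎

  NonzeroTransversal : ∀ {n} → Matrix n → Permutation′ n → Set ℓ
  NonzeroTransversal T σ = ∀ i → T (σ ⟨$⟩ʳ i) i ≉ 0#

  insert-nonzeroTransversal : ∀ {n} {T : Matrix (suc n)} {k σ} → T k zero ≉ 0# →
                              NonzeroTransversal (minor T k) σ →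
                              NonzeroTransversal T (insert zero k σ)
  insert-nonzeroTransversal Tk0≉0 σ-nonzero zero = Tk0≉0
  insert-nonzeroTransversal {T = T} {k} {σ} Tk0≉0 σ-nonzero (suc i) =
    σ-nonzero i ∘ ≡.subst (λ p → T p (suc i) ≈ 0#) (insert-punchIn zero k σ i)

  leftInvertible⇒¬¬nonzeroTransversal : ∀ {n} {T U : Matrix n} → (U ·ᴹ T) ≈ᴹ Iᴹ →
                                        ¬ ¬ ∃ (NonzeroTransversal T)
  leftInvertible⇒¬¬nonzeroTransversal {zero} _ ¬∃ = ¬∃ (Perm.id , λ ())
  leftInvertible⇒¬¬nonzeroTransversal {suc n} {T} {U} U·T≈I ¬∃ =
    ∑≉0⇒¬¬∃≉0 (λ k → U zero k * T k zero) [U·T]₀₀≉0 λ (k , pivot≉0) →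
      let y , uy≈1 = inverse (U zero k) (xy≉0⇒x≉0 pivot≉0) in
      leftInvertible⇒¬¬nonzeroTransversal (reducedInverse-leftInverse {T = T} {U} U·T≈I k uy≈1)
        λ (σ , σ-nonzero) → ¬∃ (insert zero k σ ,
          insert-nonzeroTransversal {T = T} (xy≉0⇒y≉0 pivot≉0) σ-nonzero)
    where
    [U·T]₀₀≉0 : (U ·ᴹ T) zero zero ≉ 0#
    [U·T]₀₀≉0 = 1≉0 ∘ trans (sym (trans (U·T≈I zero zero) (δ-refl {suc n} zero)))

  scaledElem-entry : ∀ {n} (G : Digraph n) (coef : Fin n → Fin n → Carrier) k l p q →
                     (if G k l then coef k l ∙ᴹ Elem k l else 0ᴹ) p q
                       ≈ δ p k * (δ q l * (if G k l then coef k l else 0#))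
  scaledElem-entry G coef k l p q with G k l
  ... | true = begin
    coef k l * (δ k p * δ l q) ≈⟨ *-congˡ (*-cong (δ-sym k p) (δ-sym l q)) ⟩
    coef k l * (δ p k * δ q l) ≈⟨ x∙yz≈y∙xz _ _ _ ⟩
    δ p k * (coef k l * δ q l) ≈⟨ *-congˡ (*-comm _ _) ⟩
    δ p k * (δ q l * coef k l) ∎
  ... | false = sym (trans (*-congˡ (zeroʳ _)) (zeroʳ _))

  span-entry : ∀ {n} (G : Digraph n) (coef : Fin n → Fin n → Carrier) p q →
               ∑ᴹ (λ k → ∑ᴹ (λ l → if G k l then coef k l ∙ᴹ Elem k l else 0ᴹ)) p q
                 ≈ (if G p q then coef p q else 0#)
  span-entry G coef p q = begin
    ∑ᴹ (λ k → ∑ᴹ (λ l → term k l)) p q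
      ≈⟨ trans (∑ᴹ-entry (λ k → ∑ᴹ (term k)) p q) (∑-cong λ k → ∑ᴹ-entry (term k) p q) ⟩
    ∑ (λ k → ∑ (λ l → term k l p q))
      ≈⟨ ∑-cong (λ k → ∑-cong (λ l → scaledElem-entry G coef k l p q)) ⟩
    ∑ (λ k → ∑ (λ l → δ p k * (δ q l * g k l)))
      ≈⟨ ∑-cong (λ k → sym (*-distribˡ-∑ (δ p k) (λ l → δ q l * g k l))) ⟩
    ∑ (λ k → δ p k * ∑ (λ l → δ q l * g k l))
      ≈⟨ ∑-cong (λ k → *-congˡ (∑-δ q (g k))) ⟩
    ∑ (λ k → δ p k * g k q)
      ≈⟨ ∑-δ p (λ k → g k q) ⟩
    g p q ∎
    where
    term : _ → _ → Matrix _
    term k l = if G k l then coef k l ∙ᴹ Elem k l else 0ᴹ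
    g : Fin _ → Fin _ → Carrier
    g k l = if G k l then coef k l else 0#

  Elem∈𝒮 : ∀ {n} (G : Digraph n) {i j} → G i j ≡ true → Elem i j ∈𝒮 G
  Elem∈𝒮 G {i} {j} Gij = coef , λ p q → sym (trans (span-entry G coef p q) (off-arc-zero p q))
    where
    coef : Fin _ → Fin _ → Carrier
    coef k l = δ i k * δ j l
    off-arc-zero : ∀ p q → (if G p q then coef p q else 0#) ≈ coef p q
    off-arc-zero p q with G p q in Gpq | i ≟ p | j ≟ q
    ... | true | _ | _ = refl
    ... | false | no _ | _ = sym (zeroˡ _)
    ... | false | yes _ | no _ = sym (zeroʳ _)
    ... | false | yes ≡.refl | yes ≡.refl with ≡.trans (≡.sym Gij) Gpq
    ...   | ()

  ∈𝒮-offArc : ∀ {n} {M : Matrix n} {H : Digraph n} {p q} → M ∈𝒮 H → H p q ≡ false → M p q ≈ 0#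
  ∈𝒮-offArc {H = H} {p} {q} (coef , M≈span) Hpq≡false =
    trans (M≈span p q) (trans (span-entry H coef p q)
      (reflexive (≡.cong (λ b → if b then coef p q else 0#) Hpq≡false)))

  congruence-Elem : ∀ {n} (T : Matrix n) i j p q → ((T ·ᴹ Elem i j) ·ᴹ (T ᵗ)) p q ≈ T p i * T q j
  congruence-Elem T i j p q = begin
    ∑ (λ m → (T ·ᴹ Elem i j) p m * T q m)  ≈⟨ ∑-cong (λ m → *-congʳ (T·Elem m)) ⟩
    ∑ (λ m → (T p i * δ j m) * T q m)      ≈⟨ ∑-cong (λ m → xy∙z≈y∙xz (T p i) (δ j m) (T q m)) ⟩
    ∑ (λ m → δ j m * (T p i * T q m))      ≈⟨ ∑-δ j (λ m → T p i * T q m) ⟩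
    T p i * T q j                          ∎
    where
    T·Elem : ∀ m → (T ·ᴹ Elem i j) p m ≈ T p i * δ j m
    T·Elem m = trans (∑-cong (λ k → x∙yz≈y∙xz (T p k) (δ i k) (δ j m))) (∑-δ i (λ k → T p k * δ j m))

  nonzeroTransversal⇒isEmbedding : ∀ {n} (G H : Digraph n) {T σ} → CongruentInto T G H →
                                   NonzeroTransversal T σ → IsEmbedding G H σ
  nonzeroTransversal⇒isEmbedding G H {T} {σ} T𝒮Tᵗ≤𝒮H σ-nonzero i j Gij
    with H (σ ⟨$⟩ʳ i) (σ ⟨$⟩ʳ j) in Hσiσj
  ... | true = ≡.refl
  ... | false = ⊥-elim (x≉0∧y≉0⇒xy≉0 (σ-nonzero i) (σ-nonzero j) (begin
    T (σ ⟨$⟩ʳ i) i * T (σ ⟨$⟩ʳ j) j              ≈⟨ congruence-Elem T i j _ _ ⟨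
    ((T ·ᴹ Elem i j) ·ᴹ (T ᵗ)) (σ ⟨$⟩ʳ i) (σ ⟨$⟩ʳ j) ≈⟨ ∈𝒮-offArc {H = H} (T𝒮Tᵗ≤𝒮H _ (Elem∈𝒮 G Gij)) Hσiσj ⟩
    0#                                           ∎))

proposition6p2 : ∀ {c ℓ : Level} (𝔽 : Field c ℓ) (n : ℕ) (G H : Digraph n) →
    let open MatrixOver 𝔽 in
    (T : Matrix n) → Invertible T → CongruentInto T G H → IsoToSubgraph G H
proposition6p2 𝔽 n G H T (U , _ , U·T≈I) T𝒮Tᵗ≤𝒮H =
  decidable-stable (any?-Permutation n (λ {π ρ} → IsEmbedding-resp-≈ G H {π} {ρ}) (isEmbedding? G H))
    λ ¬embedding → leftInvertible⇒¬¬nonzeroTransversal 𝔽 {T = T} {U} U·T≈I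
      λ (σ , σ-nonzero) → ¬embedding (σ , nonzeroTransversal⇒isEmbedding 𝔽 G H {T} {σ} T𝒮Tᵗ≤𝒮H σ-nonzero)
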